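{- In the internal logic of $\mathcal{S}$, the formula $\forall\,\phi:\Omega.\ \phi=(\forall\,\kappa:\mathbb{K}.\ \phi)$ holds, where $\Omega$ is the subobject classifier.
   Context: Let $\mathbb{F}^+$ be the category whose objects are $\bullet^n$ for $n>0$ (the free category with strictly associative binary products on one object); a morphism $\bullet^n\to\bullet^m$ is equivalently a function $\{0,\dots,m-1\}\to\{0,\dots,n-1\}$. Let $\mathcal{N}=\mathrm{Hom}_{\mathbb{F}^+}(-,\bullet^1)$. For $U\in\mathbb{F}^+$ let $\mathrm{CLK}[U]=\omega^{\mathcal{N}(U)}$ ordered pointwise, and for $f:V\to U$ let $\mathrm{CLK}[f](\partial_V)=(\kappa\mapsto\partial_V(f^*\kappa))$. The category $\mathbb{CLK}$ has objects $(U,\partial_U)$ with $\partial_U\in\mathrm{CLK}[U]$, and morphisms $f:(V,\partial_V)\to(U,\partial_U)$ the $\mathbb{F}^+$-maps $f:V\to U$ with $\mathrm{CLK}[f](\partial_V)\le\partial_U$. $\mathcal{S}$ is the presheaf topos on $\mathbb{CLK}$, and the clock object $\mathbb{K}\in\mathcal{S}$ is given by $\mathbb{K}(U,\partial_U)=\mathcal{N}(U)$. The internal logic is interpreted by Kripke–Joyal forcing. -}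

module Defs where

open import Data.Nat using (ℕ; suc; _≤_)
open import Data.Nat.Properties using (≤-trans)
open import Data.Fin using (Fin)
open import Data.Product using (_×_)
open import Function using (_∘_; id)

-- The category F⁺.  The object •^(suc d) is represented by d : ℕ
-- (so that n = suc d > 0).  A morphism •^n → •^m is a function
-- Fin m → Fin n.

-- 𝒩(•^n) = Hom_{F⁺}(•^n, •^1) = functions Fin 1 → Fin n
𝒩 : ℕ → Set
𝒩 d = Fin 1 → Fin (suc d)

CLK : ℕ → Set
CLK d = 𝒩 d → ℕ

record Obj : Set where
  constructor ob
  field
    dim : ℕ
    ∂   : CLK dim

open Obj public

-- f : (V,∂V) → (U,∂U) : an F⁺-map V → U (a function Fin |U| → Fin |V|)
-- with CLK[f](∂V) ≤ ∂U pointwise, where CLK[f](∂V)(κ) = ∂V(f*κ)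
-- and f*κ = κ ∘_{F⁺} f, which as a function is  fun ∘ κ.
record Hom (V U : Obj) : Set where
  constructor hom
  field
    fun  : Fin (suc (dim U)) → Fin (suc (dim V))
    .mono : ∀ (κ : 𝒩 (dim U)) → ∂ V (fun ∘ κ) ≤ ∂ U κ

open Hom public

idH : ∀ {X} → Hom X X
idH = hom id (λ κ → Data.Nat.Properties.≤-refl)

_∘H_ : ∀ {W V U} → Hom V U → Hom W V → Hom W U
hom f pf ∘H hom g pg = hom (g ∘ f) (λ κ → ≤-trans (pg (f ∘ κ)) (pf κ))

𝕂 : Obj → Set
𝕂 X = 𝒩 (dim X)

_·𝕂_ : ∀ {Y X} → 𝕂 X → Hom Y X → 𝕂 Y
κ ·𝕂 f = fun f ∘ κ

record Sieve (X : Obj) : Set₁ where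
  field
    mem    : ∀ {Y} → Hom Y X → Set
    closed : ∀ {Y Z} (f : Hom Y X) (g : Hom Z Y) → mem f → mem (f ∘H g)

open Sieve public

Ω : Obj → Set₁
Ω = Sieve

-- restriction of sieves along f : Y → X  (pullback f*S)
-- (the inequality field of Hom is irrelevant, so composition is
-- definitionally associative and unital)
_·Ω_ : ∀ {Y X} → Ω X → Hom Y X → Ω Y
S ·Ω f = record
  { mem    = λ g → mem S (f ∘H g)
  ; closed = λ g h p → closed S (f ∘H g) h p }

_≐_ : ∀ {X} → Ω X → Ω X → Set
_≐_ {X} S T = ∀ {Y} (g : Hom Y X) → (mem S g → mem T g) × (mem T g → mem S g)

-- Kripke–Joyal forcing (shallow embedding).  A formula at stage X
-- with parameters from X is represented by its forcing relation at all
-- later stages g : Y → X.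

Formula : Obj → Set₁
Formula X = ∀ {Y} → Hom Y X → Set

atom : ∀ {X} → Ω X → Formula X
atom φ g = mem (φ ·Ω g) idH

-- ∀ κ : 𝕂. ψ  where ψ does not mention κ :
-- Y ⊩ ∀κ:𝕂. ψ  iff  for all h : W → Y and κ ∈ 𝕂(W),  W ⊩ ψ·h
∀𝕂 : ∀ {X} → Formula X → Formula X
∀𝕂 ψ g = ∀ {W} (h : Hom W _) (κ : 𝕂 W) → ψ (g ∘H h)

⟦∀𝕂_⟧ : ∀ {X} → Formula X → Ω X
⟦∀𝕂 ψ ⟧ = record
  { mem    = ∀𝕂 ψ
  ; closed = λ g h p h' κ → p (h ∘H h') κ }

_⊩_==_ : (X : Obj) → Ω X → Ω X → Set
X ⊩ φ == ψ = φ ≐ ψ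

module Submission where

-- The formula ∀κ:𝕂. φ does not mention κ, so it agrees with φ
-- as soon as two facts hold:
--   * forcing is persistent (stable under restriction along any map), which
--     for an atom φ : Ω is exactly the closure of the sieve φ under
--     precomposition; this gives φ ⊢ ∀κ:𝕂. φ;
--   * the clock object is inhabited at every stage (𝕂(W) = 𝒩(W) contains the
--     first projection •^n → •^1), so instantiating the quantifier at the
--     identity stage gives ∀κ:𝕂. φ ⊢ φ.  Throughout we use that
-- atom φ g is, by definition, membership of g in φ (composition with idH
-- is definitionally trivial).

open import Defs
open import Data.Fin using (zero)
open import Data.Product using (_,_)

Persistent : ∀ {X} → Formula X → Set
Persistent {X} ψ = ∀ {Y Z} (g : Hom Y X) (h : Hom Z Y) → ψ g → ψ (g ∘H h)

atom-persistent : ∀ {X} (φ : Ω X) → Persistent (atom φ)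
atom-persistent φ g h p = closed φ g h p

-- The clock object has an element at every stage: the map •^1 → •^n
-- picking out the first coordinate.
clockElement : (W : Obj) → 𝕂 W
clockElement W = λ _ → zero

∀𝕂-intro : ∀ {X Y} (ψ : Formula X) → Persistent ψ → (g : Hom Y X) → ψ g → ∀𝕂 ψ g
∀𝕂-intro ψ persistent g p h κ = persistent g h p

∀𝕂-elim : ∀ {X Y} (ψ : Formula X) (g : Hom Y X) → ∀𝕂 ψ g → ψ g
∀𝕂-elim {Y = Y} ψ g p = p idH (clockElement Y)

mainTheorem2 : (X : Obj) → ∀ {Y : Obj} (f : Hom Y X) (φ : Ω Y) → Y ⊩ φ == ⟦∀𝕂 atom φ ⟧
mainTheorem2 X f φ g =
  ∀𝕂-intro (atom φ) (atom-persistent φ) g , ∀𝕂-elim (atom φ) g
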